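{- Let $\mathcal{M}$ be a dependence epistemic model, $s\in S$, let $\mathcal{P}$ be either $\mathcal{P}_g$ or $\mathcal{P}_l$, and let $W\subseteq\mathbb{V}$ be nonempty finite. Put $\Sigma(s,W)=\{W'\in\mathcal{P}(s)\mid W'\subseteq W\}$. The following are equivalent: (a) $W$ is generative from $\mathcal{P}(s)$; (b) $\bigcup\Sigma(s,W)=W$, and for every nonempty $Z\subsetneq W$ there is $W'\in\Sigma(s,W)$ with $W'\cap Z\neq\emptyset$ and $W'\cap(W\setminus Z)\neq\emptyset$; (c) $\bigcup\Sigma(s,W)=W$, and for every nonempty $\Gamma\subsetneq\Sigma(s,W)$, $(\bigcup\Gamma)\cap(\bigcup(\Sigma(s,W)\setminus\Gamma))\neq\emptyset$; (d) $\bigcup\Sigma(s,W)=W$, and, defining $\mathcal{R}W_1'W_2'$ iff $W_1'\cap W_2'\neq\emptyset$ for $W_1',W_2'\in\Sigma(s,W)$, any two $W_1',W_2'\in\Sigma(s,W)$ are connected by a finite chain of $\mathcal{R}$-related elements of $\Sigma(s,W)$.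
   Context: Fix a countable set $\mathbb{P}$ of propositions and a countable set $\mathbb{V}$ of variables. A dependence epistemic model is $\mathcal{M}=\langle S,T,V,U,\sim_i,\approx\rangle$ where $S$ is a set of worlds, $T:S\times\mathbb{P}\to\{0,1\}$, $V\supseteq\mathbb{V}$ is a countable set of variables, $U:S\times V\to\mathbb{N}$, and $\sim_i,\approx$ are equivalence relations on $S$. For $X\subseteq V$, $X_u=X_v$ means $U(u,x)=U(v,x)$ for all $x\in X$. For $u,v\in S$, $\Delta(u,v)=\{x\in\mathbb{V}\mid U(u,x)\neq U(v,x)\}$ if $(V\setminus\mathbb{V})_u=(V\setminus\mathbb{V})_v$, and $\Delta(u,v)=\emptyset$ otherwise. $W$ is an evidence of $\langle X,Y\rangle$ iff $W\cap X\neq\emptyset$, $W\cap Y\neq\emptyset$, $W\subseteq X\cup Y$. $\mathcal{P}_g(s)=\{\Delta(u,v)\mid u,v\in S,\ u\approx v\approx s,\ \Delta(u,v)\text{ nonempty finite}\}$ and $\mathcal{P}_l(s)=\{\Delta(t,s)\mid t\in S,\ t\approx s,\ \Delta(t,s)\text{ nonempty finite}\}$. A nonempty finite $W\subseteq\mathbb{V}$ is generative from $\mathcal{P}(s)$ iff for all finite $X,Y\subseteq\mathbb{V}$ such that $W$ is an evidence of $\langle X,Y\rangle$, there is $W'\in\mathcal{P}(s)$ that is also an evidence of $\langle X,Y\rangle$. -}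

module Defs where

open import Level using (Level; 0ℓ) renaming (suc to lsuc)
open import Data.Nat using (ℕ)
open import Data.Bool using (Bool)
open import Data.List using (List)
open import Data.List.Membership.Propositional using (_∈_)
open import Data.Product using (Σ; ∃; ∃-syntax; _×_; _,_)
open import Function.Definitions using (Injective)
open import Relation.Binary.PropositionalEquality using (_≡_; _≢_)
open import Relation.Binary.Structures using (IsEquivalence)
open import Relation.Binary.Construct.Closure.ReflexiveTransitive using (Star)
open import Relation.Nullary using (¬_)
open import Relation.Unary using (Pred; _⊆_; _≐_; _∩_; _∪_; Satisfiable)

Countable : Set → Set
Countable A = Σ (A → ℕ) λ f → Injective _≡_ _≡_ f

-- Subsets of the base variables 𝕍 (a type `BVar`) are predicates.

Subset : Set → Set₁
Subset A = Pred A 0ℓ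

Family : Set → Set₁
Family A = Pred (Subset A) 0ℓ

Finite : {A : Set} → Subset A → Set
Finite {A} X = ∃[ xs ] (X ⊆ λ x → x ∈ xs)

Nonempty : {A : Set} → Subset A → Set
Nonempty X = Satisfiable X

-- Dependence epistemic models.
-- Parameters: agent index type `Ag` (for the relations ∼ᵢ),
-- propositions `Prp` (= ℙ), base variables `BVar` (= 𝕍).

record DEM (Ag Prp BVar : Set) : Set₁ where
  field
    S      : Set
    T      : S → Prp → Bool
    V      : Set
    V-countable : Countable V
    -- 𝕍 ⊆ V, realised as an injective embedding
    ι      : BVar → V
    ι-inj  : Injective _≡_ _≡_ ι
    U      : S → V → ℕ
    _∼[_]_ : S → Ag → S → Set
    ∼-equiv : (i : Ag) → IsEquivalence (λ u v → u ∼[ i ] v)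
    _≈_    : S → S → Set
    ≈-equiv : IsEquivalence _≈_

  NonBase : V → Set
  NonBase y = ¬ (∃[ x ] (ι x ≡ y))

  AgreeOutside : S → S → Set
  AgreeOutside u v = (y : V) → NonBase y → U u y ≡ U v y

  -- Δ(u,v) = {x ∈ 𝕍 | U(u,x) ≠ U(v,x)} if (V∖𝕍)_u = (V∖𝕍)_v, and ∅ otherwise.
  Δ : S → S → Subset BVar
  Δ u v x = AgreeOutside u v × U u (ι x) ≢ U v (ι x)

  𝒫g : S → Family BVar
  𝒫g s W' = ∃[ u ] ∃[ v ] (u ≈ v × v ≈ s × Δ u v ≐ W'
                           × Nonempty (Δ u v) × Finite (Δ u v))

  𝒫l : S → Family BVar
  𝒫l s W' = ∃[ t ] (t ≈ s × Δ t s ≐ W'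
                    × Nonempty (Δ t s) × Finite (Δ t s))

Evidence : {A : Set} → Subset A → Subset A → Subset A → Set
Evidence W X Y = Nonempty (W ∩ X) × Nonempty (W ∩ Y) × (W ⊆ X ∪ Y)

Generative : {A : Set} → Family A → Subset A → Set₁
Generative {A} 𝒫 W =
  Nonempty W × Finite W ×
  ((X Y : Subset A) → Finite X → Finite Y → Evidence W X Y →
     ∃[ W' ] (𝒫 W' × Evidence W' X Y))

Below : {A : Set} → Family A → Subset A → Family A
Below 𝒫 W W' = 𝒫 W' × (W' ⊆ W)

⋃ : {A : Set} → Family A → Pred A (lsuc 0ℓ)
⋃ F x = ∃[ W' ] (F W' × W' x)

_∖ᶠ_ : {A : Set} → Family A → Family A → Family A
(F ∖ᶠ G) W' = F W' × ¬ G W'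

_∖_ : {A : Set} → Subset A → Subset A → Subset A
(X ∖ Y) x = X x × ¬ Y x

-- a family is a genuine set of sets: closed under extensional equality
Extensional : {A : Set} → Family A → Set₁
Extensional {A} F = {W₁ W₂ : Subset A} → W₁ ≐ W₂ → F W₁ → F W₂

𝓡In : {A : Set} → Family A → Subset A → Subset A → Set
𝓡In F W₁ W₂ = F W₁ × F W₂ × Nonempty (W₁ ∩ W₂)

ChainConnected : {A : Set} → Family A → Subset A → Subset A → Set₁
ChainConnected F W₁ W₂ = Star (𝓡In F) W₁ W₂

CondB : {A : Set} → Family A → Subset A → Set₁
CondB {A} Σ' W =
  (⋃ Σ' ≐ W) ×
  ((Z : Subset A) → Nonempty Z → Z ⊆ W → ¬ (Z ≐ W) →
     ∃[ W' ] (Σ' W' × Nonempty (W' ∩ Z) × Nonempty (W' ∩ (W ∖ Z))))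

CondC : {A : Set} → Family A → Subset A → Set₁
CondC {A} Σ' W =
  (⋃ Σ' ≐ W) ×
  ((Γ : Family A) → Extensional Γ → Satisfiable Γ → Γ ⊆ Σ' → ¬ (Γ ≐ Σ') →
     Satisfiable (⋃ Γ ∩ ⋃ (Σ' ∖ᶠ Γ)))

CondD : {A : Set} → Family A → Subset A → Set₁
CondD {A} Σ' W =
  (⋃ Σ' ≐ W) ×
  ({W₁ W₂ : Subset A} → Σ' W₁ → Σ' W₂ → ChainConnected Σ' W₁ W₂)

data Kind : Set where
  global local : Kind

module _ {Ag Prp BVar : Set} (M : DEM Ag Prp BVar) where
  open DEM M
  𝒫[_] : Kind → S → Family BVar
  𝒫[ global ] = 𝒫g
  𝒫[ local ]  = 𝒫l

-- (b), (c) and (d) are equivalent for any family Σ of nonempty sets with ⋃Σ = W. If Γ is a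
-- nonempty proper subfamily with ⋃Γ disjoint from ⋃(Σ ∖ Γ), then Z = ⋃Γ is a nonempty
-- proper subset of W (the members outside Γ are nonempty) straddled by no member, so (b)
-- gives (c). If (d) fails, the chain-connected
-- component of a member is such a Γ. And a chain from a member meeting Z to one leaving Z
-- contains a member straddling Z, so (d) gives (b). Generativity is (b) for Σ = Σ(s,W): an
-- evidence of ⟨X,Y⟩ below W straddles W ∩ X, and a straddler of Z is an evidence of ⟨Z, W ∖ Z⟩.
module Submission where

open import Defs
open import Level using (0ℓ; _⊔_; Lift; lift; lower) renaming (suc to lsuc)
open import Axiom.ExcludedMiddle using (ExcludedMiddle)
open import Data.Product using (_×_; _,_; proj₁; proj₂; ∃-syntax)
open import Data.Sum using (_⊎_; inj₁; inj₂; [_,_])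
open import Data.List using (_∷_; [])
open import Data.List.Relation.Unary.Any using (here)
open import Data.Empty using (⊥-elim)
open import Function.Base using (_∘_)
open import Function.Bundles using (_⇔_; mk⇔)
open import Relation.Nullary using (yes; no; ¬_)
open import Relation.Nullary.Decidable using (True; map′; toWitness; fromWitness)
open import Relation.Binary.PropositionalEquality using (_≡_; refl)
open import Relation.Unary using (Pred; _⊆_; _≐_; _∩_; _∪_; Satisfiable)
open import Relation.Unary.Properties using (≐-trans)
open import Relation.Binary.Construct.Closure.ReflexiveTransitive using (ε; _◅_; _◅◅_)

lowerExcludedMiddle : ∀ {a b} → ExcludedMiddle (a ⊔ b) → ExcludedMiddle a
lowerExcludedMiddle {a} {b} em = map′ lower lift (em {Lift b _})

module _ {a} {B : Set a} (em : ExcludedMiddle a) where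

  ⊆⊎∃∖ : (X Y : Pred B 0ℓ) → X ⊆ Y ⊎ ∃[ x ] (X x × ¬ Y x)
  ⊆⊎∃∖ X Y with em {∃[ x ] (X x × ¬ Y x)}
  ... | yes witness = inj₂ witness
  ... | no none = inj₁ λ {x} Xx → decideY x Xx
    where
    decideY : ∀ x → X x → Y x
    decideY x Xx with lowerExcludedMiddle {b = a} em {Y x}
    ... | yes Yx = Yx
    ... | no ¬Yx = ⊥-elim (none (x , Xx , ¬Yx))

  ⊂⇒∃∖ : {X Y : Pred B 0ℓ} → Y ⊆ X → ¬ (Y ≐ X) → ∃[ x ] (X x × ¬ Y x)
  ⊂⇒∃∖ {X} {Y} Y⊆X Y≉X with ⊆⊎∃∖ X Y
  ... | inj₁ X⊆Y = ⊥-elim (Y≉X (Y⊆X , X⊆Y))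
  ... | inj₂ witness = witness

module Classical {A : Set} (em : ExcludedMiddle (lsuc 0ℓ)) where

  em₀ : ExcludedMiddle 0ℓ
  em₀ = lowerExcludedMiddle {b = lsuc 0ℓ} em

  -- Reachability and ⋃ live in Set₁, but a Family or Subset must be small: excluded middle
  -- squashes a large proposition into a small one.
  ⌊_⌋ : Set₁ → Set
  ⌊ P ⌋ = True (em {P})

  ⋃↓ : Family A → Subset A
  ⋃↓ Γ x = ⌊ ⋃ Γ x ⌋

  ⊆∪∖ : (Z W : Subset A) → W ⊆ Z ∪ (W ∖ Z)
  ⊆∪∖ Z W {x} Wx with em₀ {Z x}
  ... | yes Zx = inj₁ Zx
  ... | no ¬Zx = inj₂ (Wx , ¬Zx)

  Straddles : Subset A → Subset A → Subset A → Set
  Straddles W Z V = Nonempty (V ∩ Z) × Nonempty (V ∩ (W ∖ Z))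

  module _ (Σ' : Family A) (W : Subset A) where

    connected-member : ∀ {V₁ V₂} → Σ' V₁ → ChainConnected Σ' V₁ V₂ → Σ' V₂
    connected-member ΣV₁ ε = ΣV₁
    connected-member _ ((_ , ΣV , _) ◅ chain) = connected-member ΣV chain

    chain-straddles : (⋃ Σ' ⊆ W) → (Z : Subset A) → ∀ {V₁ V₂} → Σ' V₁ →
      Nonempty (V₁ ∩ Z) → ChainConnected Σ' V₁ V₂ → Nonempty (V₂ ∩ (W ∖ Z)) →
      ∃[ V ] (Σ' V × Straddles W Z V)
    chain-straddles _ Z {V₁} ΣV₁ inZ ε outZ = V₁ , ΣV₁ , inZ , outZ
    chain-straddles ⋃⊆W Z {V₁} ΣV₁ inZ ((_ , ΣV , (p , V₁p , Vp)) ◅ chain) outZ with em₀ {Z p}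
    ... | yes Zp = chain-straddles ⋃⊆W Z ΣV (p , Vp , Zp) chain outZ
    ... | no ¬Zp = V₁ , ΣV₁ , inZ , (p , V₁p , ⋃⊆W (V₁ , ΣV₁ , V₁p) , ¬Zp)

    condD⇒condB : CondD Σ' W → CondB Σ' W
    condD⇒condB ((⋃⊆W , W⊆⋃) , connected) = (⋃⊆W , W⊆⋃) , straddled
      where
      straddled : (Z : Subset A) → Nonempty Z → Z ⊆ W → ¬ (Z ≐ W) →
        ∃[ V ] (Σ' V × Straddles W Z V)
      straddled Z (z , Zz) Z⊆W Z≉W with ⊂⇒∃∖ em₀ Z⊆W Z≉W
      ... | w , Ww , ¬Zw with W⊆⋃ (Z⊆W Zz) | W⊆⋃ Ww
      ... | V₁ , ΣV₁ , V₁z | V₂ , ΣV₂ , V₂w =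
        chain-straddles ⋃⊆W Z ΣV₁ (z , V₁z , Zz) (connected ΣV₁ ΣV₂) (w , V₂w , Ww , ¬Zw)

    ⋃↓-⊆ : ⋃ Σ' ⊆ W → ∀ {Γ} → Γ ⊆ Σ' → ⋃↓ Γ ⊆ W
    ⋃↓-⊆ ⋃⊆W Γ⊆Σ ⋃Γx = let V , ΓV , Vx = toWitness ⋃Γx in ⋃⊆W (V , Γ⊆Σ ΓV , Vx)

    module _ (nonempty : ∀ {V} → Σ' V → Nonempty V) where

      ⋃↓-nonempty : ∀ {Γ} → Γ ⊆ Σ' → Satisfiable Γ → Nonempty (⋃↓ Γ)
      ⋃↓-nonempty Γ⊆Σ (V , ΓV) = let x , Vx = nonempty (Γ⊆Σ ΓV) in x , fromWitness (V , ΓV , Vx)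

      condB⇒condC : CondB Σ' W → CondC Σ' W
      condB⇒condC ((⋃⊆W , W⊆⋃) , straddled) = (⋃⊆W , W⊆⋃) , crossing
        where
        crossing : (Γ : Family A) → Extensional Γ → Satisfiable Γ → Γ ⊆ Σ' → ¬ (Γ ≐ Σ') →
          Satisfiable (⋃ Γ ∩ ⋃ (Σ' ∖ᶠ Γ))
        crossing Γ _ (V₀ , ΓV₀) Γ⊆Σ Γ≉Σ with ⊂⇒∃∖ em Γ⊆Σ Γ≉Σ | ⊆⊎∃∖ em₀ W (⋃↓ Γ)
        ... | V₁ , ΣV₁ , ¬ΓV₁ | inj₁ W⊆⋃Γ =
          let x , V₁x = nonempty ΣV₁ in
          x , toWitness (W⊆⋃Γ (⋃⊆W (V₁ , ΣV₁ , V₁x))) , (V₁ , (ΣV₁ , ¬ΓV₁) , V₁x)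
        ... | _ | inj₂ (w , Ww , ¬⋃Γw)
          with straddled (⋃↓ Γ) (⋃↓-nonempty Γ⊆Σ (V₀ , ΓV₀)) (⋃↓-⊆ ⋃⊆W Γ⊆Σ)
                         (λ ⋃Γ≐W → ¬⋃Γw (proj₂ ⋃Γ≐W Ww))
        ... | V , ΣV , (p , Vp , ⋃Γp) , (q , Vq , _ , ¬⋃Γq) with em₀ {Γ V}
        ...   | yes ΓV = ⊥-elim (¬⋃Γq (fromWitness (V , ΓV , Vq)))
        ...   | no ¬ΓV = p , toWitness ⋃Γp , (V , (ΣV , ¬ΓV) , Vp)

      condC⇒condD : Extensional Σ' → CondC Σ' W → CondD Σ' W
      condC⇒condD extensional (⋃≐W , crossing) = ⋃≐W , connected
        where
        connected : ∀ {V₁ V₂} → Σ' V₁ → Σ' V₂ → ChainConnected Σ' V₁ V₂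
        connected {V₁} {V₂} ΣV₁ ΣV₂ with em {ChainConnected Σ' V₁ V₂}
        ... | yes chain = chain
        ... | no ¬chain with crossing component component-extensional
                               (V₁ , fromWitness ε) component⊆Σ component≉Σ
          where
          component : Family A
          component V = ⌊ ChainConnected Σ' V₁ V ⌋
          component⊆Σ : component ⊆ Σ'
          component⊆Σ reach = connected-member ΣV₁ (toWitness reach)
          component-extensional : Extensional component
          component-extensional {U₁} U₁≐U₂ reach =
            let x , U₁x = nonempty (component⊆Σ reach) in
            fromWitness (toWitness reach ◅◅
              ((component⊆Σ reach , extensional U₁≐U₂ (component⊆Σ reach) , (x , U₁x , proj₁ U₁≐U₂ U₁x)) ◅ ε))
          component≉Σ : ¬ (component ≐ Σ')
          component≉Σ component≐Σ = ¬chain (toWitness (proj₂ component≐Σ ΣV₂))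
        ... | x , (U , reachU , Ux) , (U' , (ΣU' , ¬reachU') , U'x) =
          ⊥-elim (¬reachU' (fromWitness (toWitness reachU ◅◅
            ((connected-member ΣV₁ (toWitness reachU) , ΣU' , (x , Ux , U'x)) ◅ ε))))

  module _ (P : Family A) (W : Subset A) (W-nonempty : Nonempty W) (W-finite : Finite W) where

    finite-⊆ : ∀ {Z : Subset A} → Z ⊆ W → Finite Z
    finite-⊆ Z⊆W = proj₁ W-finite , λ Zx → proj₂ W-finite (Z⊆W Zx)

    ⊆∪⇒⊆ : ∀ {V X Y : Subset A} → X ⊆ W → Y ⊆ W → V ⊆ X ∪ Y → V ⊆ W
    ⊆∪⇒⊆ X⊆W Y⊆W V⊆X∪Y Vx = [ X⊆W , Y⊆W ] (V⊆X∪Y Vx)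

    generative⇒condB : Generative P W → CondB (Below P W) W
    generative⇒condB (_ , _ , generates) = (⋃⊆W , W⊆⋃) , straddled
      where
      ⋃⊆W : ⋃ (Below P W) ⊆ W
      ⋃⊆W (_ , (_ , V⊆W) , Vx) = V⊆W Vx
      W⊆⋃ : W ⊆ ⋃ (Below P W)
      W⊆⋃ {w} Ww with generates (_≡ w) W (w ∷ [] , λ { refl → here refl }) W-finite
                                 ((w , Ww , refl) , (w , Ww , Ww) , inj₂)
      ... | V , PV , (_ , Vw , refl) , _ , V⊆w∪W =
        V , (PV , ⊆∪⇒⊆ (λ { refl → Ww }) (λ Wx → Wx) V⊆w∪W) , Vw
      straddled : (Z : Subset A) → Nonempty Z → Z ⊆ W → ¬ (Z ≐ W) →
        ∃[ V ] (Below P W V × Straddles W Z V)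
      straddled Z (z , Zz) Z⊆W Z≉W with ⊂⇒∃∖ em₀ Z⊆W Z≉W
      ... | w , Ww , ¬Zw with generates Z (W ∖ Z) (finite-⊆ Z⊆W) (finite-⊆ proj₁)
                                ((z , Z⊆W Zz , Zz) , (w , Ww , Ww , ¬Zw) , ⊆∪∖ Z W)
      ... | V , PV , inZ , outZ , V⊆Z∪W∖Z =
        V , (PV , ⊆∪⇒⊆ Z⊆W proj₁ V⊆Z∪W∖Z) , inZ , outZ

    condB⇒generative : CondB (Below P W) W → Generative P W
    condB⇒generative ((_ , W⊆⋃) , straddled) = W-nonempty , W-finite , generates
      where
      generates : (X Y : Subset A) → Finite X → Finite Y → Evidence W X Y →
        ∃[ V ] (P V × Evidence V X Y)
      generates X Y _ _ ((a , Wa , Xa) , (b , Wb , Yb) , W⊆X∪Y) with ⊆⊎∃∖ em₀ W X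
      ... | inj₁ W⊆X =
        let V , (PV , V⊆W) , Vb = W⊆⋃ Wb in
        V , PV , (b , Vb , W⊆X Wb) , (b , Vb , Yb) , λ Vx → W⊆X∪Y (V⊆W Vx)
      ... | inj₂ (w , Ww , ¬Xw)
        with straddled (W ∩ X) (a , Wa , Xa) proj₁ (λ W∩X≐W → ¬Xw (proj₂ (proj₂ W∩X≐W Ww)))
      ... | V , (PV , V⊆W) , (p , Vp , _ , Xp) , (q , Vq , Wq , ¬W∩Xq) =
        V , PV , (p , Vp , Xp) , (q , Vq , Yq) , λ Vx → W⊆X∪Y (V⊆W Vx)
        where
        Yq : Y q
        Yq = [ (λ Xq → ⊥-elim (¬W∩Xq (Wq , Xq))) , (λ Yq → Yq) ] (W⊆X∪Y Wq)

    module _ (P-nonempty : ∀ {V} → P V → Nonempty V) (P-extensional : Extensional P) where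

      Below-nonempty : ∀ {V} → Below P W V → Nonempty V
      Below-nonempty (PV , _) = P-nonempty PV

      Below-extensional : Extensional (Below P W)
      Below-extensional V₁≐V₂ (PV₁ , V₁⊆W) = P-extensional V₁≐V₂ PV₁ , λ V₂x → V₁⊆W (proj₂ V₁≐V₂ V₂x)

      generative⇔conditions :
        (Generative P W ⇔ CondB (Below P W) W) × (Generative P W ⇔ CondC (Below P W) W)
          × (Generative P W ⇔ CondD (Below P W) W)
      generative⇔conditions =
          mk⇔ generative⇒condB condB⇒generative
        , mk⇔ (b⇒c ∘ generative⇒condB) (condB⇒generative ∘ d⇒b ∘ c⇒d)
        , mk⇔ (c⇒d ∘ b⇒c ∘ generative⇒condB) (condB⇒generative ∘ d⇒b)
        where
        b⇒c : CondB (Below P W) W → CondC (Below P W) W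
        b⇒c = condB⇒condC (Below P W) W Below-nonempty
        c⇒d : CondC (Below P W) W → CondD (Below P W) W
        c⇒d = condC⇒condD (Below P W) W Below-nonempty Below-extensional
        d⇒b : CondD (Below P W) W → CondB (Below P W) W
        d⇒b = condD⇒condB (Below P W) W

module _ {Ag Prp BVar : Set} (M : DEM Ag Prp BVar) (s : DEM.S M) where
  open DEM M

  𝒫-nonempty : (k : Kind) → ∀ {V} → 𝒫[_] M k s V → Nonempty V
  𝒫-nonempty global (_ , _ , _ , _ , Δ≐V , (x , Δx) , _) = x , proj₁ Δ≐V Δx
  𝒫-nonempty local (_ , _ , Δ≐V , (x , Δx) , _) = x , proj₁ Δ≐V Δx

  𝒫-extensional : (k : Kind) → Extensional (𝒫[_] M k s)
  𝒫-extensional global V₁≐V₂ (u , v , u≈v , v≈s , Δ≐V₁ , nonempty , finite) =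
    u , v , u≈v , v≈s , ≐-trans Δ≐V₁ V₁≐V₂ , nonempty , finite
  𝒫-extensional local V₁≐V₂ (t , t≈s , Δ≐V₁ , nonempty , finite) =
    t , t≈s , ≐-trans Δ≐V₁ V₁≐V₂ , nonempty , finite

mainTheorem5 : ExcludedMiddle (lsuc 0ℓ) →
    {Ag Prp BVar : Set} → Countable Prp → Countable BVar →
    (M : DEM Ag Prp BVar) → (s : DEM.S M) → (k : Kind) →
    (W : Subset BVar) → Nonempty W → Finite W →
    (Generative (𝒫[_] M k s) W ⇔ CondB (Below (𝒫[_] M k s) W) W)
    × (Generative (𝒫[_] M k s) W ⇔ CondC (Below (𝒫[_] M k s) W) W)
    × (Generative (𝒫[_] M k s) W ⇔ CondD (Below (𝒫[_] M k s) W) W)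
mainTheorem5 em _ _ M s k W W-nonempty W-finite =
  Classical.generative⇔conditions em (𝒫[_] M k s) W W-nonempty W-finite
    (𝒫-nonempty M s k) (𝒫-extensional M s k)
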